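{- For every fixed integer $d\ge 1$: every $n$-vertex graph of tree-depth at most $d$ has $O(n^{2^d})$ simple paths of any given length, and there exist $n$-vertex graphs of tree-depth $d$ having $\Omega(n^{2^d})$ simple paths of some single given length. Hence the number of paths of a given length in graphs of tree-depth $d$ can be $\Theta(n^{2^d})$.
   Context: The tree-depth of a connected graph $G$ is the minimum depth (length of the longest root-to-leaf path) of a rooted tree $T$ on the vertex set of $G$ such that every edge of $G$ joins an ancestor–descendant pair of $T$. The length of a path is its number of edges. -}

module Defs where

open import Data.Nat using (ℕ; zero; suc; _≤_)
open import Data.Fin using (Fin; _≟_)
open import Data.Bool using (Bool; true; false; _∧_; not)
open import Data.Maybe using (Maybe; just; nothing)
open import Data.List using (List; []; _∷_; map; concatMap; filter; length; allFin)
open import Data.Vec using (Vec; []; _∷_)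
open import Data.Sum using (_⊎_)
open import Data.Product using (_×_)
open import Relation.Nullary using (¬_)
open import Relation.Nullary.Decidable using (⌊_⌋)
open import Relation.Binary.PropositionalEquality using (_≡_)

record Graph (n : ℕ) : Set where
  field
    adj    : Fin n → Fin n → Bool
    sym    : ∀ u v → adj u v ≡ adj v u
    irrefl : ∀ v → adj v v ≡ false
open Graph public

data Anc {n : ℕ} (parent : Fin n → Maybe (Fin n)) (u : Fin n) : Fin n → Set where
  here : Anc parent u u
  up   : ∀ {v w} → parent v ≡ just w → Anc parent u w → Anc parent u v

-- An elimination forest of G of depth at most d: a rooted forest on the
-- vertex set (parent map, with a height function certifying it is acyclic:
-- roots have height 0, a child has height one more than its parent), all
-- heights (= number of edges from the root) at most d, and every edge of G
-- joins an ancestor–descendant pair.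
record ElimForest {n : ℕ} (G : Graph n) (d : ℕ) : Set where
  field
    parent       : Fin n → Maybe (Fin n)
    height       : Fin n → ℕ
    root-height  : ∀ v → parent v ≡ nothing → height v ≡ 0
    child-height : ∀ v u → parent v ≡ just u → height v ≡ suc (height u)
    bounded      : ∀ v → height v ≤ d
    edges        : ∀ u v → adj G u v ≡ true → Anc parent u v ⊎ Anc parent v u

TreeDepth≤ : ∀ {n} → Graph n → ℕ → Set
TreeDepth≤ G d = ElimForest G d

HasTreeDepth : ∀ {n} → Graph n → ℕ → Set
HasTreeDepth G zero    = TreeDepth≤ G zero
HasTreeDepth G (suc d) = TreeDepth≤ G (suc d) × ¬ TreeDepth≤ G d

allVecs : (n k : ℕ) → List (Vec (Fin n) k)
allVecs n zero    = [] ∷ []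
allVecs n (suc k) = concatMap (λ v → map (λ x → x ∷ v) (allFin n)) (allVecs n k)

notIn : ∀ {n k} → Fin n → Vec (Fin n) k → Bool
notIn x []       = true
notIn x (y ∷ ys) = not ⌊ x ≟ y ⌋ ∧ notIn x ys

isPath : ∀ {n k} → Graph n → Vec (Fin n) k → Bool
isPath G []                = true
isPath G (x ∷ [])          = true
isPath G (x ∷ (y ∷ ys))    = adj G x y ∧ notIn x (y ∷ ys) ∧ isPath G (y ∷ ys)

-- number of simple paths of length ℓ (ℓ edges, ℓ+1 distinct vertices),
-- counted as vertex sequences (each path with ℓ ≥ 1 counted once per direction)
numPaths : ∀ {n} → Graph n → ℕ → ℕ
numPaths {n} G ℓ = length (filter (λ p → isPath G p ≡? true) (allVecs n (suc ℓ)))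
  where
    open import Data.Bool.Properties using () renaming (_≟_ to _≡?_)

-- Fix an elimination forest of depth d and count, for each h,
-- the paths all of whose vertices have height ≥ h.  Such a path either
-- avoids height h, or it stays below a single vertex x of height h and
-- passes through x exactly once; cutting at x leaves two paths of height
-- > h which determine x.  Summing over all lengths, the totals therefore
-- satisfy B(h) ≤ 1 + n + B(h+1) + B(h+1)², so B(0) = O(n ^ 2 ^ d).
--
-- T 0 is an independent set of q vertices and T (d+1) the
-- cone over two copies of T d.  Its vertex classes (the q-sets at the
-- leaves and the single apexes) form a chain: picking one vertex from each
-- class gives a path, so T d has ≥ q ^ 2 ^ d paths of one fixed length.
-- A leaf with the d apexes above it is a clique, forcing tree-depth exactly
-- d.  Choosing q ≈ n / 2^(d+1) and padding with isolated vertices gives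
-- Ω(n ^ 2 ^ d).
module Submission where

open import Defs hiding (sym)
open import Data.Nat using (ℕ; suc; _≤_; _*_; _^_)
open import Data.Product using (Σ; _×_)

open import Data.Nat using (zero; _+_; _∸_; _<_; z≤n; s≤s; _≤?_; NonZero; >-nonZero)
open import Data.Nat.Properties
open import Data.Nat.DivMod using (_/_; _%_; m≡m%n+[m/n]*n; m%n<n; m/n*n≤m; m≥n⇒m/n>0)
open import Data.Nat.Tactic.RingSolver using (solve-∀)
open import Algebra.Properties.CommutativeSemigroup +-commutativeSemigroup using (interchange)
open import Data.Fin using (Fin; zero; suc; _↑ˡ_; _↑ʳ_; splitAt; toℕ; fromℕ<) renaming (_≟_ to _≟F_)
open import Data.Fin.Properties using (splitAt-↑ˡ; splitAt-↑ʳ; splitAt⁻¹-↑ˡ; splitAt⁻¹-↑ʳ; pigeonhole; toℕ-fromℕ<)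
import Data.Fin.Properties as Finₚ
open import Data.Bool using (Bool; true; false; _∧_)
import Data.Bool.Properties as Boolₚ
open import Data.Maybe using (Maybe; just; nothing; maybe)
import Data.Maybe as Maybe
open import Data.Maybe.Relation.Binary.Connected using (Connected; just; just-nothing; nothing-just)
open import Data.List using (List; []; _∷_; _++_; map; concatMap; length; filter; allFin; tabulate; last; head)
open import Data.List.Properties using (length-++; length-map)
open import Data.List.Relation.Unary.All as All using (All; []; _∷_; all?)
import Data.List.Relation.Unary.All.Properties as Allₚ
open import Data.List.Relation.Unary.AllPairs as AllPairs using (AllPairs; []; _∷_; allPairs?)
import Data.List.Relation.Unary.AllPairs.Properties as AllPairsₚ
open import Data.List.Relation.Unary.Linked as Linked using (Linked; []; [-]; _∷_; _∷′_; linked?)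
import Data.List.Relation.Unary.Linked.Properties as Linkedₚ
open import Data.List.Relation.Unary.Unique.Propositional using (Unique)
open import Data.Vec using (Vec; []; _∷_; toList)
open import Data.Product using (_,_; proj₁; proj₂)
import Data.Product as Product
open import Data.Sum using (_⊎_; inj₁; inj₂; [_,_]′)
import Data.Sum as Sum
open import Data.Empty using (⊥; ⊥-elim)
open import Relation.Nullary using (¬_; Dec; yes; no; ¬?; _×-dec_)
open import Relation.Nullary.Decidable using (⌊_⌋)
open import Relation.Unary using (Decidable)
open import Relation.Binary.PropositionalEquality
open import Function using (_∘_; const)

ind : Bool → ℕ
ind true  = 1
ind false = 0

χ : {P : Set} → Dec P → ℕ
χ d = ind ⌊ d ⌋

χ-yes : {P : Set} (d : Dec P) → P → χ d ≡ 1
χ-yes (yes _) _ = refl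
χ-yes (no ¬p) p = ⊥-elim (¬p p)

χ-no : {P : Set} (d : Dec P) → ¬ P → χ d ≡ 0
χ-no (yes p) ¬p = ⊥-elim (¬p p)
χ-no (no _)  _  = refl

χ≤1 : {P : Set} (d : Dec P) → χ d ≤ 1
χ≤1 (yes _) = ≤-refl
χ≤1 (no _)  = z≤n

χ-mono : {P Q : Set} (d : Dec P) (e : Dec Q) → (P → Q) → χ d ≤ χ e
χ-mono (no _)  e       _   = z≤n
χ-mono (yes p) (yes _) _   = ≤-refl
χ-mono (yes p) (no ¬q) p→q = ⊥-elim (¬q (p→q p))

χ-cong : {P Q : Set} (d : Dec P) (e : Dec Q) → (P → Q) → (Q → P) → χ d ≡ χ e
χ-cong d e p→q q→p = ≤-antisym (χ-mono d e p→q) (χ-mono e d q→p)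

sumL : {A : Set} → List A → (A → ℕ) → ℕ
sumL []       f = 0
sumL (a ∷ as) f = f a + sumL as f

module _ {A : Set} where
  sumL-ext : (L : List A) {f g : A → ℕ} → (∀ a → f a ≡ g a) → sumL L f ≡ sumL L g
  sumL-ext []      e = refl
  sumL-ext (a ∷ L) e = cong₂ _+_ (e a) (sumL-ext L e)

  sumL-mono : (L : List A) {f g : A → ℕ} → (∀ a → f a ≤ g a) → sumL L f ≤ sumL L g
  sumL-mono []      e = z≤n
  sumL-mono (a ∷ L) e = +-mono-≤ (e a) (sumL-mono L e)

  sumL-++ : (L K : List A) (f : A → ℕ) → sumL (L ++ K) f ≡ sumL L f + sumL K f
  sumL-++ []      K f = refl
  sumL-++ (a ∷ L) K f = trans (cong (f a +_) (sumL-++ L K f)) (sym (+-assoc (f a) _ _))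

  sumL-+ : (L : List A) (f g : A → ℕ) → sumL L (λ a → f a + g a) ≡ sumL L f + sumL L g
  sumL-+ []      f g = refl
  sumL-+ (a ∷ L) f g = trans (cong (f a + g a +_) (sumL-+ L f g)) (interchange (f a) (g a) _ _)

  sumL-*ˡ : (L : List A) (c : ℕ) (f : A → ℕ) → sumL L (λ a → c * f a) ≡ c * sumL L f
  sumL-*ˡ []      c f = sym (*-zeroʳ c)
  sumL-*ˡ (a ∷ L) c f = trans (cong (c * f a +_) (sumL-*ˡ L c f)) (sym (*-distribˡ-+ c (f a) _))

  sumL-zero : (L : List A) → sumL L (λ _ → 0) ≡ 0
  sumL-zero []      = refl
  sumL-zero (a ∷ L) = sumL-zero L

module _ {A B : Set} where
  sumL-map : (L : List A) (g : A → B) (f : B → ℕ) → sumL (map g L) f ≡ sumL L (f ∘ g)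
  sumL-map []      g f = refl
  sumL-map (a ∷ L) g f = cong (f (g a) +_) (sumL-map L g f)

  sumL-concatMap : (L : List A) (g : A → List B) (f : B → ℕ) →
                   sumL (concatMap g L) f ≡ sumL L (λ a → sumL (g a) f)
  sumL-concatMap []      g f = refl
  sumL-concatMap (a ∷ L) g f =
    trans (sumL-++ (g a) (concatMap g L) f) (cong (sumL (g a) f +_) (sumL-concatMap L g f))

  sumL-swap : (L : List A) (K : List B) (F : A → B → ℕ) →
              sumL L (λ a → sumL K (F a)) ≡ sumL K (λ b → sumL L (λ a → F a b))
  sumL-swap []      K F = sym (sumL-zero K)
  sumL-swap (a ∷ L) K F = trans (cong (sumL K (F a) +_) (sumL-swap L K F)) (sym (sumL-+ K (F a) _))

ΣF : ∀ {n} → (Fin n → ℕ) → ℕ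
ΣF {n} f = sumL (allFin n) f

sumL-tabulate : ∀ {A : Set} n (g : Fin n → A) (f : A → ℕ) → sumL (tabulate g) f ≡ ΣF (f ∘ g)
sumL-tabulate zero    g f = refl
sumL-tabulate (suc n) g f =
  cong (f (g zero) +_) (trans (sumL-tabulate n (g ∘ suc) f) (sym (sumL-tabulate n suc (f ∘ g))))

module _ {n : ℕ} where
  ΣF-suc : (f : Fin (suc n) → ℕ) → ΣF f ≡ f zero + ΣF (f ∘ suc)
  ΣF-suc f = cong (f zero +_) (sumL-tabulate n suc f)

  ΣF-ext : {f g : Fin n → ℕ} → (∀ x → f x ≡ g x) → ΣF f ≡ ΣF g
  ΣF-ext = sumL-ext (allFin n)

  ΣF-mono : {f g : Fin n → ℕ} → (∀ x → f x ≤ g x) → ΣF f ≤ ΣF g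
  ΣF-mono = sumL-mono (allFin n)

  ΣF-+ : (f g : Fin n → ℕ) → ΣF (λ x → f x + g x) ≡ ΣF f + ΣF g
  ΣF-+ = sumL-+ (allFin n)

  ΣF-*ˡ : (c : ℕ) (f : Fin n → ℕ) → ΣF (λ x → c * f x) ≡ c * ΣF f
  ΣF-*ˡ = sumL-*ˡ (allFin n)

  ΣF-*ʳ : (f : Fin n → ℕ) (c : ℕ) → ΣF (λ x → f x * c) ≡ ΣF f * c
  ΣF-*ʳ f c = trans (ΣF-ext (λ x → *-comm (f x) c)) (trans (ΣF-*ˡ c f) (*-comm c _))

  ΣF-zero : ΣF {n} (λ _ → 0) ≡ 0
  ΣF-zero = sumL-zero (allFin n)

ΣF-const : ∀ n c → ΣF {n} (λ _ → c) ≡ n * c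
ΣF-const zero    c = refl
ΣF-const (suc n) c = trans (ΣF-suc {n} (λ _ → c)) (cong (c +_) (ΣF-const n c))

ΣF-split : ∀ a b (f : Fin (a + b) → ℕ) → ΣF f ≡ ΣF (λ x → f (x ↑ˡ b)) + ΣF (λ y → f (a ↑ʳ y))
ΣF-split zero    b f = refl
ΣF-split (suc a) b f = begin
  ΣF f                                                         ≡⟨ ΣF-suc f ⟩
  f zero + ΣF (f ∘ suc)                                        ≡⟨ cong (f zero +_) (ΣF-split a b (f ∘ suc)) ⟩
  f zero + (ΣF (λ x → f (suc (x ↑ˡ b))) + ΣF (λ y → f (suc a ↑ʳ y))) ≡⟨ sym (+-assoc (f zero) _ _) ⟩
  f zero + ΣF (λ x → f (suc (x ↑ˡ b))) + ΣF (λ y → f (suc a ↑ʳ y))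
    ≡⟨ cong (_+ ΣF (λ y → f (suc a ↑ʳ y))) (sym (ΣF-suc (λ x → f (x ↑ˡ b)))) ⟩
  ΣF (λ x → f (x ↑ˡ b)) + ΣF (λ y → f (suc a ↑ʳ y))            ∎
  where open ≡-Reasoning

ΣF-delta : ∀ {n} (t : Fin n) → ΣF (λ x → χ (x ≟F t)) ≡ 1
ΣF-delta {suc n} t = trans (ΣF-suc (λ x → χ (x ≟F t))) (rest t)
  where
  rest : (t : Fin (suc n)) → χ (zero ≟F t) + ΣF (λ x → χ (suc x ≟F t)) ≡ 1
  rest zero    = cong suc (trans (ΣF-ext {n} (λ _ → refl)) (ΣF-zero {n}))
  rest (suc t) = trans (ΣF-ext (λ x → cong ind (suc-dec x t))) (ΣF-delta t)
    where
    suc-dec : ∀ x t → ⌊ suc x ≟F suc t ⌋ ≡ ⌊ x ≟F t ⌋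
    suc-dec x t with x ≟F t
    ... | yes _ = refl
    ... | no  _ = refl

sumTo : (ℕ → ℕ) → ℕ → ℕ
sumTo f zero    = 0
sumTo f (suc L) = f 0 + sumTo (f ∘ suc) L

sumTo-mono : ∀ L {f g : ℕ → ℕ} → (∀ i → f i ≤ g i) → sumTo f L ≤ sumTo g L
sumTo-mono zero    e = z≤n
sumTo-mono (suc L) e = +-mono-≤ (e 0) (sumTo-mono L (e ∘ suc))

sumTo-+ : ∀ L (f g : ℕ → ℕ) → sumTo (λ i → f i + g i) L ≡ sumTo f L + sumTo g L
sumTo-+ zero    f g = refl
sumTo-+ (suc L) f g = trans (cong (f 0 + g 0 +_) (sumTo-+ L (f ∘ suc) (g ∘ suc))) (interchange (f 0) (g 0) _ _)

sumTo-*ˡ : ∀ L c (f : ℕ → ℕ) → sumTo (λ i → c * f i) L ≡ c * sumTo f L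
sumTo-*ˡ zero    c f = sym (*-zeroʳ c)
sumTo-*ˡ (suc L) c f = trans (cong (c * f 0 +_) (sumTo-*ˡ L c (f ∘ suc))) (sym (*-distribˡ-+ c (f 0) _))

sumTo-zero : ∀ L → sumTo (λ _ → 0) L ≡ 0
sumTo-zero zero    = refl
sumTo-zero (suc L) = sumTo-zero L

sumTo-tail : ∀ L (f : ℕ → ℕ) → sumTo (f ∘ suc) L ≤ sumTo f (suc L)
sumTo-tail L f = m≤n+m _ (f 0)

sumTo-≤suc : ∀ L (f : ℕ → ℕ) → sumTo f L ≤ sumTo f (suc L)
sumTo-≤suc zero    f = z≤n
sumTo-≤suc (suc L) f = +-monoʳ-≤ (f 0) (sumTo-≤suc L (f ∘ suc))

sumTo-single : ∀ k (f : ℕ → ℕ) → f k ≤ sumTo f (suc k)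
sumTo-single zero    f = m≤m+n (f 0) 0
sumTo-single (suc k) f = ≤-trans (sumTo-single k (f ∘ suc)) (sumTo-tail (suc k) f)

diag : (ℕ → ℕ → ℕ) → ℕ → ℕ
diag A zero    = A 0 0
diag A (suc k) = A 0 (suc k) + diag (A ∘ suc) k

conv : (ℕ → ℕ) → (ℕ → ℕ) → ℕ → ℕ
conv f g = diag (λ i j → f i * g j)

diag-mono : ∀ k {A B : ℕ → ℕ → ℕ} → (∀ i j → A i j ≤ B i j) → diag A k ≤ diag B k
diag-mono zero    e = e 0 0
diag-mono (suc k) e = +-mono-≤ (e 0 (suc k)) (diag-mono k (e ∘ suc))

diag-ext : ∀ k {A B : ℕ → ℕ → ℕ} → (∀ i j → A i j ≡ B i j) → diag A k ≡ diag B k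
diag-ext zero    e = e 0 0
diag-ext (suc k) e = cong₂ _+_ (e 0 (suc k)) (diag-ext k (e ∘ suc))

ΣF-diag : ∀ {n} k (A : Fin n → ℕ → ℕ → ℕ) → ΣF (λ x → diag (A x) k) ≡ diag (λ i j → ΣF (λ x → A x i j)) k
ΣF-diag zero    A = refl
ΣF-diag (suc k) A = trans (ΣF-+ (λ x → A x 0 (suc k)) _) (cong (ΣF (λ x → A x 0 (suc k)) +_) (ΣF-diag k (λ x → A x ∘ suc)))

conv-sum : ∀ L (f g : ℕ → ℕ) → sumTo (conv f g) L ≤ sumTo f L * sumTo g L
conv-sum zero    f g = z≤n
conv-sum (suc L) f g = begin
  f 0 * g 0 + sumTo (λ i → f 0 * g (suc i) + conv (f ∘ suc) g i) L
    ≡⟨ cong (f 0 * g 0 +_) (sumTo-+ L (λ i → f 0 * g (suc i)) _) ⟩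
  f 0 * g 0 + (sumTo (λ i → f 0 * g (suc i)) L + sumTo (conv (f ∘ suc) g) L)
    ≡⟨ sym (+-assoc (f 0 * g 0) _ _) ⟩
  f 0 * g 0 + sumTo (λ i → f 0 * g (suc i)) L + sumTo (conv (f ∘ suc) g) L
    ≡⟨ cong (λ z → f 0 * g 0 + z + sumTo (conv (f ∘ suc) g) L) (sumTo-*ˡ L (f 0) (g ∘ suc)) ⟩
  f 0 * g 0 + f 0 * sumTo (g ∘ suc) L + sumTo (conv (f ∘ suc) g) L
    ≡⟨ cong (_+ sumTo (conv (f ∘ suc) g) L) (sym (*-distribˡ-+ (f 0) (g 0) _)) ⟩
  f 0 * sumTo g (suc L) + sumTo (conv (f ∘ suc) g) L
    ≤⟨ +-monoʳ-≤ (f 0 * sumTo g (suc L)) (conv-sum L (f ∘ suc) g) ⟩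
  f 0 * sumTo g (suc L) + sumTo (f ∘ suc) L * sumTo g L
    ≤⟨ +-monoʳ-≤ (f 0 * sumTo g (suc L)) (*-monoʳ-≤ (sumTo (f ∘ suc) L) (sumTo-≤suc L g)) ⟩
  f 0 * sumTo g (suc L) + sumTo (f ∘ suc) L * sumTo g (suc L)
    ≡⟨ sym (*-distribʳ-+ (sumTo g (suc L)) (f 0) _) ⟩
  sumTo f (suc L) * sumTo g (suc L) ∎
  where open ≤-Reasoning

sumSplits : {A : Set} → (List A → A → List A → ℕ) → List A → ℕ
sumSplits g []      = 0
sumSplits g (x ∷ l) = g [] x l + sumSplits (λ p → g (x ∷ p)) l

sumSplits-≥ : {A : Set} (g : List A → A → List A → ℕ) (pre : List A) (x : A) (w : List A) →
              g pre x w ≤ sumSplits g (pre ++ x ∷ w)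
sumSplits-≥ g []        x w = m≤m+n _ _
sumSplits-≥ g (p ∷ pre) x w = ≤-trans (sumSplits-≥ (λ q → g (p ∷ q)) pre x w) (m≤n+m _ _)

module VecSum (n : ℕ) where
  S : (k : ℕ) → (List (Fin n) → ℕ) → ℕ
  S k f = sumL (allVecs n k) (f ∘ toList)

  S-zero : (f : List (Fin n) → ℕ) → S 0 f ≡ f []
  S-zero f = +-identityʳ (f [])

  S-peel : ∀ k (f : List (Fin n) → ℕ) → S (suc k) f ≡ S k (λ w → ΣF (λ x → f (x ∷ w)))
  S-peel k f = trans (sumL-concatMap (allVecs n k) (λ v → map (x∷ v) (allFin n)) (f ∘ toList))
                     (sumL-ext (allVecs n k) (λ v → sumL-map (allFin n) (x∷ v) (f ∘ toList)))
    where
    x∷ : Vec (Fin n) k → Fin n → Vec (Fin n) (suc k)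
    x∷ v x = x ∷ v

  S-ext : ∀ k {f g : List (Fin n) → ℕ} → (∀ (v : Vec (Fin n) k) → f (toList v) ≡ g (toList v)) → S k f ≡ S k g
  S-ext k = sumL-ext (allVecs n k)

  S-mono : ∀ k {f g : List (Fin n) → ℕ} → (∀ (v : Vec (Fin n) k) → f (toList v) ≤ g (toList v)) → S k f ≤ S k g
  S-mono k = sumL-mono (allVecs n k)

  S-+ : ∀ k (f g : List (Fin n) → ℕ) → S k (λ l → f l + g l) ≡ S k f + S k g
  S-+ k f g = sumL-+ (allVecs n k) (f ∘ toList) (g ∘ toList)

  S-*ˡ : ∀ k c (f : List (Fin n) → ℕ) → S k (λ l → c * f l) ≡ c * S k f
  S-*ˡ k c f = sumL-*ˡ (allVecs n k) c (f ∘ toList)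

  S-*ʳ : ∀ k (f : List (Fin n) → ℕ) c → S k (λ l → f l * c) ≡ S k f * c
  S-*ʳ k f c = trans (S-ext k {λ l → f l * c} {λ l → c * f l} (λ v → *-comm (f (toList v)) c)) (trans (S-*ˡ k c f) (*-comm c _))

  S-swap : ∀ k (F : Fin n → List (Fin n) → ℕ) → S k (λ w → ΣF (λ x → F x w)) ≡ ΣF (λ x → S k (F x))
  S-swap k F = sumL-swap (allVecs n k) (allFin n) (λ v x → F x (toList v))

  S-sumSplits : ∀ ℓ (g : List (Fin n) → Fin n → List (Fin n) → ℕ) →
    S (suc ℓ) (sumSplits g) ≡ diag (λ i j → S i (λ pre → ΣF (λ x → S j (g pre x)))) ℓ
  S-sumSplits ℓ g = begin
    S (suc ℓ) (sumSplits g)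
      ≡⟨ S-peel ℓ (sumSplits g) ⟩
    S ℓ (λ w → ΣF (λ x → g [] x w + sumSplits (g ∘ (x ∷_)) w))
      ≡⟨ S-ext ℓ {λ w → ΣF (λ x → g [] x w + sumSplits (g ∘ (x ∷_)) w)} {λ w → first w + rest w}
               (λ v → ΣF-+ (λ x → g [] x (toList v)) (λ x → sumSplits (g ∘ (x ∷_)) (toList v))) ⟩
    S ℓ (λ w → ΣF (λ x → g [] x w) + ΣF (λ x → sumSplits (g ∘ (x ∷_)) w))
      ≡⟨ S-+ ℓ first rest ⟩
    S ℓ (λ w → ΣF (λ x → g [] x w)) + S ℓ (λ w → ΣF (λ x → sumSplits (g ∘ (x ∷_)) w))
      ≡⟨ cong₂ _+_ (trans (S-swap ℓ (g [])) (sym (S-zero (λ pre → ΣF (λ x → S ℓ (g pre x))))))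
                   (S-swap ℓ (λ x → sumSplits (g ∘ (x ∷_)))) ⟩
    A 0 ℓ + ΣF (λ x → S ℓ (sumSplits (g ∘ (x ∷_))))
      ≡⟨ shifted ℓ ⟩
    diag A ℓ ∎
    where
    open ≡-Reasoning
    A : ℕ → ℕ → ℕ
    A i j = S i (λ pre → ΣF (λ x → S j (g pre x)))
    first rest : List (Fin n) → ℕ
    first w = ΣF (λ x → g [] x w)
    rest  w = ΣF (λ x → sumSplits (g ∘ (x ∷_)) w)
    -- Splits with a non-empty prefix: the prefix starts with some x.
    shifted : ∀ ℓ → A 0 ℓ + ΣF (λ x → S ℓ (sumSplits (g ∘ (x ∷_)))) ≡ diag A ℓ
    shifted zero     = trans (cong (A 0 0 +_) (trans (ΣF-ext {n} (λ _ → refl)) (ΣF-zero {n}))) (+-identityʳ _)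
    shifted (suc ℓ′) = cong (A 0 (suc ℓ′) +_) (begin
      ΣF (λ x → S (suc ℓ′) (sumSplits (g ∘ (x ∷_))))
        ≡⟨ ΣF-ext (λ x → S-sumSplits ℓ′ (g ∘ (x ∷_))) ⟩
      ΣF (λ x → diag (λ i j → S i (λ pre → ΣF (λ y → S j (g (x ∷ pre) y)))) ℓ′)
        ≡⟨ ΣF-diag ℓ′ (λ x i j → S i (λ pre → ΣF (λ y → S j (g (x ∷ pre) y)))) ⟩
      diag (λ i j → ΣF (λ x → S i (λ pre → ΣF (λ y → S j (g (x ∷ pre) y))))) ℓ′
        ≡⟨ diag-ext ℓ′ (λ i j → sym (trans (S-peel i (λ pre → ΣF (λ y → S j (g pre y))))
                                          (S-swap i (λ x pre → ΣF (λ y → S j (g (x ∷ pre) y)))))) ⟩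
      diag (A ∘ suc) ℓ′ ∎)

module _ {A : Set} {R : A → A → Set} where
  Linked-++⁻ : ∀ xs {ys} → Linked R (xs ++ ys) → Linked R xs × Linked R ys
  Linked-++⁻ []            l         = [] , l
  Linked-++⁻ (x ∷ [])      l         = [-] , Linked.tail l
  Linked-++⁻ (x ∷ y ∷ xs) (r ∷ l) = Product.map₁ (r ∷_) (Linked-++⁻ (y ∷ xs) l)

  AllPairs-++⁻ : ∀ xs {ys} → AllPairs R (xs ++ ys) → AllPairs R xs × AllPairs R ys
  AllPairs-++⁻ []       ps       = [] , ps
  AllPairs-++⁻ (x ∷ xs) (p ∷ ps) = Product.map₁ (Allₚ.++⁻ˡ xs p ∷_) (AllPairs-++⁻ xs ps)

  AllPairs-mid : ∀ xs {y ys} → AllPairs R (xs ++ y ∷ ys) → All (λ x → R x y) xs × All (R y) ys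
  AllPairs-mid []       (p ∷ _)  = [] , p
  AllPairs-mid (x ∷ xs) (p ∷ ps) with Allₚ.++⁻ʳ xs p
  ... | r ∷ _ = Product.map₁ (r ∷_) (AllPairs-mid xs ps)

record Split {A : Set} (l : List A) : Set where
  constructor split
  field
    pre  : List A
    mid  : A
    post : List A
    eq   : l ≡ pre ++ mid ∷ post

long-split : ∀ {A : Set} (pre : List A) x w → 2 ≤ length (pre ++ x ∷ w) → pre ++ w ≢ []
long-split []      x []      (s≤s ()) _
long-split []      x (_ ∷ _) _        ()
long-split (_ ∷ _) x w       _        ()

∧-true⁻ : ∀ {a b} → a ∧ b ≡ true → a ≡ true × b ≡ true
∧-true⁻ {true} e = refl , e

∧-true⁺ : ∀ {a b} → a ≡ true → b ≡ true → a ∧ b ≡ true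
∧-true⁺ refl e = e

adjacent-distinct : ∀ {n} (G : Graph n) {u v} → adj G u v ≡ true → u ≢ v
adjacent-distinct G {u} e refl with trans (sym (irrefl G u)) e
... | ()

module Paths {n : ℕ} (G : Graph n) where
  open VecSum n

  Edge : Fin n → Fin n → Set
  Edge u v = adj G u v ≡ true

  Path : List (Fin n) → Set
  Path l = Linked Edge l × Unique l

  path? : Decidable Path
  path? l = linked? (λ u v → adj G u v Boolₚ.≟ true) l ×-dec allPairs? (λ x y → ¬? (x ≟F y)) l

  notIn-sound : ∀ {k} x (v : Vec (Fin n) k) → notIn x v ≡ true → All (x ≢_) (toList v)
  notIn-sound x []      _ = []
  notIn-sound x (y ∷ v) e with x ≟F y
  ... | no x≢y = x≢y ∷ notIn-sound x v e

  notIn-complete : ∀ {k} x (v : Vec (Fin n) k) → All (x ≢_) (toList v) → notIn x v ≡ true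
  notIn-complete x []      _             = refl
  notIn-complete x (y ∷ v) (x≢y ∷ rest) with x ≟F y
  ... | yes x≡y = ⊥-elim (x≢y x≡y)
  ... | no  _   = notIn-complete x v rest

  isPath-sound : ∀ {k} (v : Vec (Fin n) k) → isPath G v ≡ true → Path (toList v)
  isPath-sound []          _ = [] , []
  isPath-sound (x ∷ [])    _ = [-] , ([] ∷ [])
  isPath-sound (x ∷ y ∷ v) e =
    let xy , e′         = ∧-true⁻ {adj G x y} e
        fresh , rest    = ∧-true⁻ {notIn x (y ∷ v)} e′
        linked , unique = isPath-sound (y ∷ v) rest
    in xy ∷ linked , notIn-sound x (y ∷ v) fresh ∷ unique

  isPath-complete : ∀ {k} (v : Vec (Fin n) k) → Path (toList v) → isPath G v ≡ true
  isPath-complete []          _ = refl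
  isPath-complete (x ∷ [])    _ = refl
  isPath-complete (x ∷ y ∷ v) (xy ∷ linked , fresh ∷ unique) =
    ∧-true⁺ xy (∧-true⁺ (notIn-complete x (y ∷ v) fresh) (isPath-complete (y ∷ v) (linked , unique)))

  numPaths-S : ∀ ℓ → numPaths G ℓ ≡ S (suc ℓ) (χ ∘ path?)
  numPaths-S ℓ = filter-length (allVecs n (suc ℓ))
    where
    filter-length : ∀ {k} (L : List (Vec (Fin n) k)) →
      length (filter (λ p → isPath G p Boolₚ.≟ true) L) ≡ sumL L (χ ∘ path? ∘ toList)
    filter-length []      = refl
    filter-length (v ∷ L) with isPath G v Boolₚ.≟ true | path? (toList v)
    ... | yes _ | yes _ = cong suc (filter-length L)
    ... | yes e | no ¬p = ⊥-elim (¬p (isPath-sound v e))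
    ... | no ¬e | yes p = ⊥-elim (¬e (isPath-complete v p))
    ... | no _  | no _  = filter-length L

module Forest {n : ℕ} {G : Graph n} {d : ℕ} (F : ElimForest G d) where
  open ElimForest F

  _≼_ : Fin n → Fin n → Set
  u ≼ v = Anc parent u v

  ≼-height : ∀ {u v} → u ≼ v → height u ≤ height v
  ≼-height here = ≤-refl
  ≼-height (up {v} {w} e a) rewrite child-height v w e = m≤n⇒m≤1+n (≼-height a)

  -- A proper ancestor is strictly higher up, so an ancestor of equal height is the vertex itself.
  ≼-same-height : ∀ {u v} → u ≼ v → height u ≡ height v → u ≡ v
  ≼-same-height here             _ = refl
  ≼-same-height (up {v} {w} e a) h = ⊥-elim (<-irrefl h (begin-strict
    height _ ≤⟨ ≼-height a ⟩
    height w <⟨ n<1+n (height w) ⟩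
    suc (height w) ≡⟨ child-height v w e ⟨
    height v ∎))
    where open ≤-Reasoning

  ≼-trans : ∀ {u v w} → u ≼ v → v ≼ w → u ≼ w
  ≼-trans a here     = a
  ≼-trans a (up e b) = up e (≼-trans a b)

  ≼-chain : ∀ {a b v} → a ≼ v → b ≼ v → a ≼ b ⊎ b ≼ a
  ≼-chain here       b≼v        = inj₂ b≼v
  ≼-chain (up e a≼w) here       = inj₁ (up e a≼w)
  ≼-chain (up e a≼w) (up e′ b≼w′) with trans (sym e) e′
  ... | refl = ≼-chain a≼w b≼w′

  ≼-unique : ∀ {a b v} → a ≼ v → b ≼ v → height a ≡ height b → a ≡ b
  ≼-unique a≼v b≼v h with ≼-chain a≼v b≼v
  ... | inj₁ a≼b = ≼-same-height a≼b h
  ... | inj₂ b≼a = sym (≼-same-height b≼a (sym h))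

  climb : ℕ → Fin n → Fin n
  climb zero    v = v
  climb (suc k) v = maybe (climb k) v (parent v)

  climb-spec : ∀ k v → k ≤ height v → climb k v ≼ v × height (climb k v) + k ≡ height v
  climb-spec zero    v _ = here , +-identityʳ (height v)
  climb-spec (suc k) v k<h with parent v in e
  ... | nothing = ⊥-elim (<⇒≱ k<h (≤-trans (≤-reflexive (root-height v e)) z≤n))
  ... | just w with climb-spec k w (≤-pred (≤-trans k<h (≤-reflexive (child-height v w e))))
  ...   | c≼w , hc = up e c≼w , trans (+-suc _ k) (trans (cong suc hc) (sym (child-height v w e)))

  -- The ancestor of v at height h (meaningful when h ≤ height v).
  ancAt : ℕ → Fin n → Fin n
  ancAt h v = climb (height v ∸ h) v

  ancAt-spec : ∀ {h v} → h ≤ height v → ancAt h v ≼ v × height (ancAt h v) ≡ h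
  ancAt-spec {h} {v} h≤v with climb-spec (height v ∸ h) v (m∸n≤m (height v) h)
  ... | a≼v , ha = a≼v , +-cancelʳ-≡ _ _ _ (trans ha (sym (m+[n∸m]≡n h≤v)))

  ancAt-self : ∀ {h v} → height v ≡ h → ancAt h v ≡ v
  ancAt-self {h} {v} refl rewrite n∸n≡0 (height v) = refl

  ≼-ancAt : ∀ {h u v} → u ≼ v → h ≤ height u → ancAt h u ≡ ancAt h v
  ≼-ancAt u≼v h≤u with ancAt-spec h≤u | ancAt-spec (≤-trans h≤u (≼-height u≼v))
  ... | a≼u , ha | b≼v , hb = ≼-unique (≼-trans a≼u u≼v) b≼v (trans ha (sym hb))

  -- Adjacent vertices are comparable and distinct, so they have different heights.
  adjacent-heights : ∀ {u v} → adj G u v ≡ true → height u ≢ height v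
  adjacent-heights {u} {v} e same with edges u v e
  ... | inj₁ u≼v = adjacent-distinct G e (≼-same-height u≼v same)
  ... | inj₂ v≼u = adjacent-distinct G e (sym (≼-same-height v≼u (sym same)))

  edge-ancAt : ∀ {h u v} → adj G u v ≡ true → h ≤ height u → h ≤ height v → ancAt h u ≡ ancAt h v
  edge-ancAt {u = u} {v} e h≤u h≤v with edges u v e
  ... | inj₁ u≼v = ≼-ancAt u≼v h≤u
  ... | inj₂ v≼u = sym (≼-ancAt v≼u h≤v)

-- The bound on the number of paths within m levels of a forest on n vertices.
levelBound : ℕ → ℕ → ℕ
levelBound n zero    = 1
levelBound n (suc m) = 1 + (n + (levelBound n m + levelBound n m * levelBound n m))

module Levels {n : ℕ} (G : Graph n) {d : ℕ} (F : ElimForest G d) where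
  open ElimForest F
  open Forest F
  open Paths G
  open VecSum n

  Above : ℕ → Fin n → Set
  Above h v = h ≤ height v

  HighPath : ℕ → List (Fin n) → Set
  HighPath h l = Path l × All (Above h) l

  highPath? : ∀ h → Decidable (HighPath h)
  highPath? h l = path? l ×-dec all? (λ v → h ≤? height v) l

  P : ℕ → ℕ → ℕ
  P h k = S k (χ ∘ highPath? h)

  below-one-root : ∀ {h l} → HighPath h l → Linked (λ u v → ancAt h u ≡ ancAt h v) l
  below-one-root {h} ((linked , _) , above) = go linked above
    where
    go : ∀ {l} → Linked Edge l → All (Above h) l → Linked (λ u v → ancAt h u ≡ ancAt h v) l
    go []       _                 = []
    go [-]      _                 = [-]
    go (e ∷ lk) (hu ∷ hv ∷ above) = edge-ancAt e hu hv ∷ go lk (hv ∷ above)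

  strictly-below : ∀ {h x ys} → height x ≡ h → All (λ y → ancAt h y ≡ x) ys → All (_≢ x) ys →
                   All (Above h) ys → All (Above (suc h)) ys
  strictly-below hx []           []             []           = []
  strictly-below hx (a ∷ anc) (y≢x ∷ distinct) (h≤y ∷ above) =
    ≤∧≢⇒< h≤y (λ h≡y → y≢x (trans (sym (ancAt-self (sym h≡y))) a)) ∷ strictly-below hx anc distinct above

  cut-at-root : ∀ {h} pre x w → HighPath h (pre ++ x ∷ w) → height x ≡ h →
                All (λ y → ancAt h y ≡ x) (pre ++ w) × HighPath (suc h) pre × HighPath (suc h) w
  cut-at-root {h} pre x w hp@((linked , unique) , above) hx =
    Allₚ.++⁺ ancPre ancW ,
    ((linked-pre , unique-pre) , strictly-below hx ancPre distinct-pre above-pre) ,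
    ((Linked.tail linked-rest , AllPairs.tail unique-rest) ,
      strictly-below hx ancW (All.map ≢-sym distinct-w) (All.tail above-rest))
    where
    linked-pre : Linked Edge pre
    linked-pre = proj₁ (Linked-++⁻ pre linked)
    linked-rest : Linked Edge (x ∷ w)
    linked-rest = proj₂ (Linked-++⁻ pre linked)
    unique-pre : Unique pre
    unique-pre = proj₁ (AllPairs-++⁻ pre unique)
    unique-rest : Unique (x ∷ w)
    unique-rest = proj₂ (AllPairs-++⁻ pre unique)
    distinct-pre : All (_≢ x) pre
    distinct-pre = proj₁ (AllPairs-mid pre unique)
    distinct-w : All (x ≢_) w
    distinct-w = proj₂ (AllPairs-mid pre unique)
    above-pre : All (Above h) pre
    above-pre = Allₚ.++⁻ˡ pre above
    above-rest : All (Above h) (x ∷ w)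
    above-rest = Allₚ.++⁻ʳ pre above
    same-root : All (λ y → ancAt h y ≡ ancAt h x) pre × All (λ y → ancAt h x ≡ ancAt h y) w
    same-root = AllPairs-mid pre (Linkedₚ.Linked⇒AllPairs trans (below-one-root hp))
    ancPre : All (λ y → ancAt h y ≡ x) pre
    ancPre = All.map (λ e → trans e (ancAt-self hx)) (proj₁ same-root)
    ancW : All (λ y → ancAt h y ≡ x) w
    ancW = All.map (λ e → trans (sym e) (ancAt-self hx)) (proj₂ same-root)

  low-vertex : ∀ h (l : List (Fin n)) → ¬ All (Above (suc h)) l →
               Σ (Split l) λ s → height (Split.mid s) ≤ h
  low-vertex h []      ¬above = ⊥-elim (¬above [])
  low-vertex h (y ∷ l) ¬above with suc h ≤? height y
  ... | no y≤h = split [] y l refl , ≤-pred (≰⇒> y≤h)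
  ... | yes h<y with low-vertex h l (λ above → ¬above (h<y ∷ above))
  ...   | split pre x w eq , x≤h = split (y ∷ pre) x w (cong (y ∷_) eq) , x≤h

  anchor : ℕ → List (Fin n) → Fin n → Set
  anchor h []      x = ⊥
  anchor h (y ∷ _) x = x ≡ ancAt h y

  anchor? : ∀ h l x → Dec (anchor h l x)
  anchor? h []      x = no λ ()
  anchor? h (y ∷ _) x = x ≟F ancAt h y

  ΣF-anchor : ∀ h l → ΣF (λ x → χ (anchor? h l x)) ≤ 1
  ΣF-anchor h []      = ≤-trans (≤-reflexive (trans (ΣF-ext {n} (λ _ → refl)) (ΣF-zero {n}))) z≤n
  ΣF-anchor h (y ∷ _) = ≤-reflexive (ΣF-delta (ancAt h y))

  weight : ℕ → List (Fin n) → Fin n → List (Fin n) → ℕ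
  weight h pre x w = χ (anchor? h (pre ++ w) x) * (χ (highPath? (suc h) pre) * χ (highPath? (suc h) w))

  -- A path of height ≥ h with at least two vertices is either of height > h,
  -- or it has a split of weight 1 (cut at its unique vertex of height h).
  decompose : ∀ h (l : List (Fin n)) → 2 ≤ length l →
              χ (highPath? h l) ≤ χ (highPath? (suc h) l) + sumSplits (weight h) l
  decompose h l long with highPath? h l | highPath? (suc h) l
  ... | no _   | _      = z≤n
  ... | yes _  | yes _  = s≤s z≤n
  ... | yes hp | no ¬hp with low-vertex h l (λ above → ¬hp (proj₁ hp , above))
  ...   | split pre x w refl , x≤h = begin
    1                                  ≡⟨ sym weight≡1 ⟩
    weight h pre x w                   ≤⟨ sumSplits-≥ (weight h) pre x w ⟩
    sumSplits (weight h) (pre ++ x ∷ w) ∎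
    where
    open ≤-Reasoning
    hx : height x ≡ h
    hx = ≤-antisym x≤h (All.head (Allₚ.++⁻ʳ pre (proj₂ hp)))
    cut : All (λ y → ancAt h y ≡ x) (pre ++ w) × HighPath (suc h) pre × HighPath (suc h) w
    cut = cut-at-root pre x w hp hx
    anchored : ∀ {l} → All (λ y → ancAt h y ≡ x) l → l ≢ [] → anchor h l x
    anchored []      l≢[] = l≢[] refl
    anchored (a ∷ _) _    = sym a
    weight≡1 : weight h pre x w ≡ 1
    weight≡1 rewrite χ-yes (anchor? h (pre ++ w) x) (anchored (proj₁ cut) (long-split pre x w long))
                   | χ-yes (highPath? (suc h) pre) (proj₁ (proj₂ cut))
                   | χ-yes (highPath? (suc h) w) (proj₂ (proj₂ cut)) = refl

  weights-bound : ∀ h i j → S i (λ pre → ΣF (λ x → S j (weight h pre x))) ≤ P (suc h) i * P (suc h) j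
  weights-bound h i j = begin
    S i (λ pre → ΣF (λ x → S j (weight h pre x)))
      ≤⟨ S-mono i {λ pre → ΣF (λ x → S j (weight h pre x))} {λ pre → high pre * P (suc h) j}
                  (λ v → per-prefix (toList v)) ⟩
    S i (λ pre → high pre * P (suc h) j)
      ≡⟨ S-*ʳ i high (P (suc h) j) ⟩
    P (suc h) i * P (suc h) j ∎
    where
    open ≤-Reasoning
    high : List (Fin n) → ℕ
    high = χ ∘ highPath? (suc h)
    per-prefix : ∀ pre → ΣF (λ x → S j (weight h pre x)) ≤ high pre * P (suc h) j
    per-prefix pre = begin
      ΣF (λ x → S j (weight h pre x))
        ≡⟨ sym (S-swap j (weight h pre)) ⟩
      S j (λ w → ΣF (λ x → χ (anchor? h (pre ++ w) x) * (high pre * high w)))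
        ≡⟨ S-ext j {λ w → ΣF (λ x → χ (anchor? h (pre ++ w) x) * (high pre * high w))}
                   {λ w → ΣF (λ x → χ (anchor? h (pre ++ w) x)) * (high pre * high w)}
                   (λ v → ΣF-*ʳ (λ x → χ (anchor? h (pre ++ toList v) x)) (high pre * high (toList v))) ⟩
      S j (λ w → ΣF (λ x → χ (anchor? h (pre ++ w) x)) * (high pre * high w))
        ≤⟨ S-mono j {λ w → ΣF (λ x → χ (anchor? h (pre ++ w) x)) * (high pre * high w)}
                    {λ w → high pre * high w}
                    (λ v → ≤-trans (*-monoˡ-≤ _ (ΣF-anchor h (pre ++ toList v))) (≤-reflexive (*-identityˡ _))) ⟩
      S j (λ w → high pre * high w)
        ≡⟨ S-*ˡ j (high pre) high ⟩
      high pre * P (suc h) j ∎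

  level-step : ∀ h ℓ → P h (2 + ℓ) ≤ P (suc h) (2 + ℓ) + conv (P (suc h)) (P (suc h)) (suc ℓ)
  level-step h ℓ = begin
    P h (2 + ℓ)
      ≤⟨ S-mono (2 + ℓ) {χ ∘ highPath? h} {λ l → χ (highPath? (suc h) l) + sumSplits (weight h) l}
                (λ { (a ∷ b ∷ v) → decompose h (a ∷ b ∷ toList v) (s≤s (s≤s z≤n)) }) ⟩
    S (2 + ℓ) (λ l → χ (highPath? (suc h) l) + sumSplits (weight h) l)
      ≡⟨ S-+ (2 + ℓ) (χ ∘ highPath? (suc h)) (sumSplits (weight h)) ⟩
    P (suc h) (2 + ℓ) + S (2 + ℓ) (sumSplits (weight h))
      ≡⟨ cong (P (suc h) (2 + ℓ) +_) (S-sumSplits (suc ℓ) (weight h)) ⟩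
    P (suc h) (2 + ℓ) + diag (λ i j → S i (λ pre → ΣF (λ x → S j (weight h pre x)))) (suc ℓ)
      ≤⟨ +-monoʳ-≤ (P (suc h) (2 + ℓ)) (diag-mono (suc ℓ) (weights-bound h)) ⟩
    P (suc h) (2 + ℓ) + conv (P (suc h)) (P (suc h)) (suc ℓ) ∎
    where open ≤-Reasoning

  P-one : ∀ h → P h 1 ≤ n
  P-one h = begin
    P h 1                                          ≡⟨ S-peel 0 (χ ∘ highPath? h) ⟩
    S 0 (λ w → ΣF (λ x → χ (highPath? h (x ∷ w)))) ≡⟨ S-zero (λ w → ΣF (λ x → χ (highPath? h (x ∷ w)))) ⟩
    ΣF (λ x → χ (highPath? h (x ∷ [])))            ≤⟨ ΣF-mono (λ x → χ≤1 (highPath? h (x ∷ []))) ⟩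
    ΣF {n} (λ _ → 1)                               ≡⟨ ΣF-const n 1 ⟩
    n * 1                                          ≡⟨ *-identityʳ n ⟩
    n                                              ∎
    where open ≤-Reasoning

  -- No vertex has height above d.
  P-top : ∀ k → P (suc d) (suc k) ≡ 0
  P-top k = trans (S-ext (suc k) {χ ∘ highPath? (suc d)} {λ _ → 0} none) (sumL-zero (allVecs n (suc k)))
    where
    none : (v : Vec (Fin n) (suc k)) → χ (highPath? (suc d) (toList v)) ≡ 0
    none (x ∷ v) = χ-no (highPath? (suc d) (x ∷ toList v)) (λ hp → <⇒≱ (All.head (proj₂ hp)) (bounded x))

  total-bound : ∀ m h → m + h ≡ suc d → ∀ L → sumTo (P h) L ≤ levelBound n m
  total-bound zero    .(suc d) refl zero    = z≤n
  total-bound zero    .(suc d) refl (suc L) =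
    s≤s (≤-trans (sumTo-mono L (λ i → ≤-reflexive (P-top i))) (≤-reflexive (sumTo-zero L)))
  total-bound (suc m) h e zero          = z≤n
  total-bound (suc m) h e (suc zero)    = s≤s z≤n
  total-bound (suc m) h e (suc (suc L)) = begin
    1 + (P h 1 + sumTo (λ i → P h (2 + i)) L)
      ≤⟨ s≤s (+-mono-≤ (P-one h) (sumTo-mono L (level-step h))) ⟩
    1 + (n + sumTo (λ i → M (2 + i) + conv M M (suc i)) L)
      ≡⟨ cong (λ z → 1 + (n + z)) (sumTo-+ L (λ i → M (2 + i)) (λ i → conv M M (suc i))) ⟩
    1 + (n + (sumTo (λ i → M (2 + i)) L + sumTo (λ i → conv M M (suc i)) L))
      ≤⟨ s≤s (+-monoʳ-≤ n (+-mono-≤ (≤-trans (sumTo-tail L (M ∘ suc)) (sumTo-tail (suc L) M))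
                                     (sumTo-tail L (conv M M)))) ⟩
    1 + (n + (sumTo M (2 + L) + sumTo (conv M M) (suc L)))
      ≤⟨ s≤s (+-monoʳ-≤ n (+-mono-≤ (IH (2 + L))
                                     (≤-trans (conv-sum (suc L) M M) (*-mono-≤ (IH (suc L)) (IH (suc L)))))) ⟩
    levelBound n (suc m) ∎
    where
    open ≤-Reasoning
    M : ℕ → ℕ
    M = P (suc h)
    IH : ∀ L → sumTo M L ≤ levelBound n m
    IH = total-bound m (suc h) (trans (+-suc m h) e)

  paths-bound : ∀ ℓ → numPaths G ℓ ≤ levelBound n (suc d)
  paths-bound ℓ = begin
    numPaths G ℓ            ≡⟨ numPaths-S ℓ ⟩
    S (suc ℓ) (χ ∘ path?)   ≡⟨ S-ext (suc ℓ) {χ ∘ path?} {χ ∘ highPath? 0} (λ v → χ-cong (path? (toList v)) _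
                                     (λ p → p , All.universal (λ _ → z≤n) (toList v)) proj₁) ⟩
    P 0 (suc ℓ)             ≤⟨ sumTo-single (suc ℓ) (P 0) ⟩
    sumTo (P 0) (2 + ℓ)     ≤⟨ total-bound (suc d) 0 (+-identityʳ (suc d)) (2 + ℓ) ⟩
    levelBound n (suc d)    ∎
    where open ≤-Reasoning

numPaths-empty : (G : Graph 0) (ℓ : ℕ) → numPaths G ℓ ≡ 0
numPaths-empty G ℓ =
  trans (Paths.numPaths-S G ℓ) (trans (VecSum.S-peel 0 ℓ (χ ∘ Paths.path? G)) (sumL-zero (allVecs 0 ℓ)))

-- Constants of the upper bound: levelBound n (suc m) ≤ K m * n ^ (2 ^ m).
K : ℕ → ℕ
K zero    = 4
K (suc m) = 2 + (K m + K m * K m)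

n≤n^e : ∀ n e → 1 ≤ n → 1 ≤ e → n ≤ n ^ e
n≤n^e (suc n) (suc e) _ _ = ≤-trans (≤-reflexive (sym (*-identityʳ (suc n)))) (*-monoʳ-≤ (suc n) (m^n>0 (suc n) e))

^-double : ∀ n m → n ^ (2 ^ suc m) ≡ n ^ (2 ^ m) * n ^ (2 ^ m)
^-double n m = trans (cong (λ e → n ^ (2 ^ m + e)) (+-identityʳ (2 ^ m))) (^-distribˡ-+-* n (2 ^ m) (2 ^ m))

square-step : ∀ {n b k p} → 1 ≤ p → n ≤ p → b ≤ k * p → 1 + (n + (b + b * b)) ≤ (2 + (k + k * k)) * (p * p)
square-step {n} {b} {k} {p} 1≤p n≤p b≤kp = begin
  1 + (n + (b + b * b))               ≤⟨ +-mono-≤ 1≤pp (+-mono-≤ (≤-trans n≤p p≤pp) (+-mono-≤ b≤kpp b²≤k²pp)) ⟩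
  p * p + (p * p + (k * (p * p) + (k * k) * (p * p))) ≡⟨ collect k (p * p) ⟩
  (2 + (k + k * k)) * (p * p)         ∎
  where
  open ≤-Reasoning
  1≤pp : 1 ≤ p * p
  1≤pp = *-mono-≤ 1≤p 1≤p
  p≤pp : p ≤ p * p
  p≤pp = ≤-trans (≤-reflexive (sym (*-identityʳ p))) (*-monoʳ-≤ p 1≤p)
  b≤kpp : b ≤ k * (p * p)
  b≤kpp = ≤-trans b≤kp (*-monoʳ-≤ k p≤pp)
  b²≤k²pp : b * b ≤ (k * k) * (p * p)
  b²≤k²pp = ≤-trans (*-mono-≤ b≤kp b≤kp) (≤-reflexive (rearrange k p))
    where
    rearrange : ∀ k p → (k * p) * (k * p) ≡ (k * k) * (p * p)
    rearrange = solve-∀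
  collect : ∀ k q → q + (q + (k * q + (k * k) * q)) ≡ (2 + (k + k * k)) * q
  collect = solve-∀

levelBound-poly : ∀ n m → 1 ≤ n → levelBound n (suc m) ≤ K m * n ^ (2 ^ m)
levelBound-poly n zero 1≤n = begin
  1 + (n + (1 + 1)) ≡⟨ three n ⟩
  n + 3 * 1         ≤⟨ +-monoʳ-≤ n (*-monoʳ-≤ 3 1≤n) ⟩
  n + 3 * n         ≡⟨ four n ⟩
  4 * (n * 1)       ∎
  where
  open ≤-Reasoning
  three : ∀ n → 1 + (n + (1 + 1)) ≡ n + 3 * 1
  three = solve-∀
  four : ∀ n → n + 3 * n ≡ 4 * (n * 1)
  four = solve-∀
levelBound-poly n (suc m) 1≤n = begin
  levelBound n (2 + m)
    ≤⟨ square-step {k = K m} (1≤n^2^m 1≤n) (n≤n^e n (2 ^ m) 1≤n (m^n>0 2 m)) (levelBound-poly n m 1≤n) ⟩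
  K (suc m) * (n ^ (2 ^ m) * n ^ (2 ^ m))
    ≡⟨ cong (K (suc m) *_) (sym (^-double n m)) ⟩
  K (suc m) * n ^ (2 ^ suc m) ∎
  where
  open ≤-Reasoning
  1≤n^2^m : 1 ≤ n → 1 ≤ n ^ (2 ^ m)
  1≤n^2^m (s≤s _) = m^n>0 n (2 ^ m)

upper-bound : ∀ d → Σ ℕ λ C → ∀ (n : ℕ) (G : Graph n) → TreeDepth≤ G d →
              ∀ (ℓ : ℕ) → numPaths G ℓ ≤ C * n ^ (2 ^ d)
upper-bound d = K d , bound
  where
  bound : ∀ (n : ℕ) (G : Graph n) → TreeDepth≤ G d → ∀ (ℓ : ℕ) → numPaths G ℓ ≤ K d * n ^ (2 ^ d)
  bound zero    G F ℓ = ≤-trans (≤-reflexive (numPaths-empty G ℓ)) z≤n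
  bound (suc n) G F ℓ = ≤-trans (Levels.paths-bound G F ℓ) (levelBound-poly (suc n) d (s≤s z≤n))

Cls : ℕ → Set
Cls N = Fin N → Bool

size : ∀ {N} → Cls N → ℕ
size C = ΣF (ind ∘ C)

Disjoint : ∀ {N} → Cls N → Cls N → Set
Disjoint C C′ = ∀ x → C x ≡ true → C′ x ≡ false

disjoint-distinct : ∀ {N} {C C′ : Cls N} {x y} → Disjoint C C′ → C x ≡ true → C′ y ≡ true → x ≢ y
disjoint-distinct {x = x} dj cx c′y refl with trans (sym (dj x cx)) c′y
... | ()

Joined : ∀ {N} → Graph N → Cls N → Cls N → Set
Joined G C C′ = ∀ x y → C x ≡ true → C′ y ≡ true → adj G x y ≡ true

-- A chain of classes: pairwise disjoint, each completely joined to the next.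
-- Picking one vertex from each class of a chain yields a path.
Chain : ∀ {N} → Graph N → List (Cls N) → Set
Chain G cs = AllPairs Disjoint cs × Linked (Joined G) cs

Π : ∀ {N} → List (Cls N) → ℕ
Π []       = 1
Π (C ∷ cs) = size C * Π cs

Π-++ : ∀ {N} (xs ys : List (Cls N)) → Π (xs ++ ys) ≡ Π xs * Π ys
Π-++ []       ys = sym (+-identityʳ (Π ys))
Π-++ (C ∷ xs) ys = trans (cong (size C *_) (Π-++ xs ys)) (sym (*-assoc (size C) _ _))

picks : ∀ {N} → List (Cls N) → List (Fin N) → Bool
picks []       []      = true
picks (C ∷ cs) (x ∷ l) = C x ∧ picks cs l
picks []       (_ ∷ _) = false
picks (_ ∷ _)  []      = false

picks-∷ : ∀ {N} (C : Cls N) cs x l → picks (C ∷ cs) (x ∷ l) ≡ true → C x ≡ true × picks cs l ≡ true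
picks-∷ C cs x l = ∧-true⁻ {C x}

ind-∧ : ∀ a b → ind (a ∧ b) ≡ ind a * ind b
ind-∧ true  b = sym (+-identityʳ (ind b))
ind-∧ false b = refl

S-picks : ∀ {N} (cs : List (Cls N)) → VecSum.S N (length cs) (ind ∘ picks cs) ≡ Π cs
S-picks []       = refl
S-picks {N} (C ∷ cs) = begin
  S (suc (length cs)) (ind ∘ picks (C ∷ cs))
    ≡⟨ S-peel (length cs) (ind ∘ picks (C ∷ cs)) ⟩
  S (length cs) (λ w → ΣF (λ x → ind (C x ∧ picks cs w)))
    ≡⟨ S-ext (length cs) {λ w → ΣF (λ x → ind (C x ∧ picks cs w))} {λ w → size C * ind (picks cs w)}
         (λ v → trans (ΣF-ext (λ x → ind-∧ (C x) (picks cs (toList v)))) (ΣF-*ʳ (ind ∘ C) _)) ⟩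
  S (length cs) (λ w → size C * ind (picks cs w))
    ≡⟨ S-*ˡ (length cs) (size C) (ind ∘ picks cs) ⟩
  size C * S (length cs) (ind ∘ picks cs)
    ≡⟨ cong (size C *_) (S-picks cs) ⟩
  size C * Π cs ∎
  where
  open ≡-Reasoning
  open VecSum N

module _ {N : ℕ} (G : Graph N) where
  open Paths G

  picks-linked : ∀ {cs l} → Linked (Joined G) cs → picks cs l ≡ true → Linked Edge l
  picks-linked {[]}           {[]}         _         _ = []
  picks-linked {C ∷ []}       {x ∷ []}     _         _ = [-]
  picks-linked {C ∷ []}       {x ∷ y ∷ l}  _         e with ∧-true⁻ {C x} e
  ... | _ , ()
  picks-linked {C ∷ C′ ∷ cs}  {x ∷ []}     _         e with ∧-true⁻ {C x} e
  ... | _ , ()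
  picks-linked {C ∷ C′ ∷ cs}  {x ∷ y ∷ l}  (j ∷ js) e with picks-∷ C (C′ ∷ cs) x (y ∷ l) e
  ... | cx , e′ = j x y cx (proj₁ (picks-∷ C′ cs y l e′)) ∷ picks-linked js e′

  picks-fresh : ∀ {C : Cls N} {cs x l} → All (Disjoint C) cs → C x ≡ true → picks cs l ≡ true → All (x ≢_) l
  picks-fresh {l = []}    _            _  _ = []
  picks-fresh {cs = C′ ∷ cs} {x} {y ∷ l} (dj ∷ djs) cx e with picks-∷ C′ cs y l e
  ... | c′y , e′ = disjoint-distinct dj cx c′y ∷ picks-fresh djs cx e′

  picks-unique : ∀ {cs l} → AllPairs Disjoint cs → picks cs l ≡ true → Unique l
  picks-unique {[]}     {[]}    _          _ = []
  picks-unique {C ∷ cs} {x ∷ l} (dj ∷ djs) e with picks-∷ C cs x l e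
  ... | cx , e′ = picks-fresh dj cx e′ ∷ picks-unique djs e′

  chain-paths : ∀ {cs} ℓ → Chain G cs → length cs ≡ suc ℓ → Π cs ≤ numPaths G ℓ
  chain-paths {cs} ℓ (disjoint , joined) len = begin
    Π cs                                    ≡⟨ sym (S-picks cs) ⟩
    S (length cs) (ind ∘ picks cs)          ≡⟨ cong (λ k → S k (ind ∘ picks cs)) len ⟩
    S (suc ℓ) (ind ∘ picks cs)              ≤⟨ S-mono (suc ℓ) {ind ∘ picks cs} {χ ∘ path?} (picked ∘ toList) ⟩
    S (suc ℓ) (χ ∘ path?)                   ≡⟨ sym (numPaths-S ℓ) ⟩
    numPaths G ℓ                            ∎
    where
    open ≤-Reasoning
    open VecSum N
    picked : ∀ l → ind (picks cs l) ≤ χ (path? l)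
    picked l with picks cs l in e
    ... | false = z≤n
    ... | true  = ≤-reflexive (sym (χ-yes (path? l) (picks-linked joined e , picks-unique disjoint e)))

chain-map : ∀ {A B} {GA : Graph A} {GB : Graph B} (f : Cls A → Cls B) →
            (∀ {C C′} → Disjoint C C′ → Disjoint (f C) (f C′)) →
            (∀ {C C′} → Joined GA C C′ → Joined GB (f C) (f C′)) →
            ∀ {cs} → Chain GA cs → Chain GB (map f cs)
chain-map f disjoint joined (ds , js) =
  AllPairsₚ.map⁺ (AllPairs.map disjoint ds) , Linkedₚ.map⁺ (Linked.map joined js)

Π-map : ∀ {A B} (f : Cls A → Cls B) → (∀ C → size (f C) ≡ size C) → ∀ cs → Π (map f cs) ≡ Π cs
Π-map f same []       = refl
Π-map f same (C ∷ cs) = cong₂ _*_ (same C) (Π-map f same cs)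

Anc-map : ∀ {a c} {p : Fin a → Maybe (Fin a)} {p′ : Fin c → Maybe (Fin c)} (f : Fin a → Fin c) →
          (∀ v w → p v ≡ just w → p′ (f v) ≡ just (f w)) → ∀ {x y} → Anc p x y → Anc p′ (f x) (f y)
Anc-map f par here        = here
Anc-map f par (up e x≼w) = up (par _ _ e) (Anc-map f par x≼w)

EmptyG : ∀ m → Graph m
EmptyG m = record { adj = λ _ _ → false ; sym = λ _ _ → refl ; irrefl = λ _ → refl }

emptyF : ∀ m d → ElimForest (EmptyG m) d
emptyF m d = record
  { parent = λ _ → nothing ; height = λ _ → 0 ; root-height = λ _ _ → refl
  ; child-height = λ _ _ () ; bounded = λ _ → z≤n ; edges = λ _ _ () }

module Union {a b : ℕ} (G : Graph a) (H : Graph b) where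
  uadj : Fin a ⊎ Fin b → Fin a ⊎ Fin b → Bool
  uadj (inj₁ x) (inj₁ y) = adj G x y
  uadj (inj₂ x) (inj₂ y) = adj H x y
  uadj _        _        = false

  uadj-sym : ∀ s t → uadj s t ≡ uadj t s
  uadj-sym (inj₁ x) (inj₁ y) = Graph.sym G x y
  uadj-sym (inj₂ x) (inj₂ y) = Graph.sym H x y
  uadj-sym (inj₁ _) (inj₂ _) = refl
  uadj-sym (inj₂ _) (inj₁ _) = refl

  uadj-irrefl : ∀ s → uadj s s ≡ false
  uadj-irrefl (inj₁ x) = irrefl G x
  uadj-irrefl (inj₂ x) = irrefl H x

  Union : Graph (a + b)
  Union = record { adj    = λ u v → uadj (splitAt a u) (splitAt a v)
                 ; sym    = λ u v → uadj-sym (splitAt a u) (splitAt a v)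
                 ; irrefl = λ v → uadj-irrefl (splitAt a v) }

  adj-↑ˡ : ∀ x y → adj Union (x ↑ˡ b) (y ↑ˡ b) ≡ adj G x y
  adj-↑ˡ x y rewrite splitAt-↑ˡ a x b | splitAt-↑ˡ a y b = refl

  left : Cls a → Cls (a + b)
  left C = [ C , const false ]′ ∘ splitAt a

  right : Cls b → Cls (a + b)
  right C = [ const false , C ]′ ∘ splitAt a

  size-left : ∀ C → size (left C) ≡ size C
  size-left C = begin
    size (left C)                                                   ≡⟨ ΣF-split a b (ind ∘ left C) ⟩
    ΣF (λ x → ind (left C (x ↑ˡ b))) + ΣF (λ y → ind (left C (a ↑ʳ y)))
      ≡⟨ cong₂ _+_ (ΣF-ext (λ x → cong (ind ∘ [ C , const false ]′) (splitAt-↑ˡ a x b)))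
                   (trans (ΣF-ext (λ y → cong (ind ∘ [ C , const false ]′) (splitAt-↑ʳ a b y))) (ΣF-zero {b})) ⟩
    size C + 0                                                      ≡⟨ +-identityʳ (size C) ⟩
    size C                                                          ∎
    where open ≡-Reasoning

  size-right : ∀ C → size (right C) ≡ size C
  size-right C = begin
    size (right C)                                                  ≡⟨ ΣF-split a b (ind ∘ right C) ⟩
    ΣF (λ x → ind (right C (x ↑ˡ b))) + ΣF (λ y → ind (right C (a ↑ʳ y)))
      ≡⟨ cong₂ _+_ (trans (ΣF-ext (λ x → cong (ind ∘ [ const false , C ]′) (splitAt-↑ˡ a x b))) (ΣF-zero {a}))
                   (ΣF-ext (λ y → cong (ind ∘ [ const false , C ]′) (splitAt-↑ʳ a b y))) ⟩
    size C                                                          ∎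
    where open ≡-Reasoning

  left-disjoint : ∀ {C C′} → Disjoint C C′ → Disjoint (left C) (left C′)
  left-disjoint dj u with splitAt a u
  ... | inj₁ x = dj x
  ... | inj₂ _ = λ ()

  right-disjoint : ∀ {C C′} → Disjoint C C′ → Disjoint (right C) (right C′)
  right-disjoint dj u with splitAt a u
  ... | inj₁ _ = λ ()
  ... | inj₂ y = dj y

  left-right-disjoint : ∀ {C C′} → Disjoint (left C) (right C′)
  left-right-disjoint u with splitAt a u
  ... | inj₁ _ = λ _ → refl
  ... | inj₂ _ = λ ()

  left-joined : ∀ {C C′} → Joined G C C′ → Joined Union (left C) (left C′)
  left-joined j u v with splitAt a u | splitAt a v
  ... | inj₁ x | inj₁ y = j x y
  ... | inj₁ _ | inj₂ _ = λ _ ()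
  ... | inj₂ _ | _      = λ ()

  right-joined : ∀ {C C′} → Joined H C C′ → Joined Union (right C) (right C′)
  right-joined j u v with splitAt a u | splitAt a v
  ... | inj₂ x | inj₂ y = j x y
  ... | inj₂ _ | inj₁ _ = λ _ ()
  ... | inj₁ _ | _      = λ ()

  module _ {d : ℕ} (FG : ElimForest G d) (FH : ElimForest H d) where
    module FG = ElimForest FG
    module FH = ElimForest FH

    parentˢ : Fin a ⊎ Fin b → Maybe (Fin (a + b))
    parentˢ (inj₁ x) = Maybe.map (_↑ˡ b) (FG.parent x)
    parentˢ (inj₂ y) = Maybe.map (a ↑ʳ_) (FH.parent y)

    heightˢ : Fin a ⊎ Fin b → ℕ
    heightˢ (inj₁ x) = FG.height x
    heightˢ (inj₂ y) = FH.height y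

    root-heightˢ : ∀ s → parentˢ s ≡ nothing → heightˢ s ≡ 0
    root-heightˢ (inj₁ x) _ with FG.parent x in e
    ... | nothing = FG.root-height x e
    root-heightˢ (inj₂ y) _ with FH.parent y in e
    ... | nothing = FH.root-height y e

    child-heightˢ : ∀ s u → parentˢ s ≡ just u → heightˢ s ≡ suc (heightˢ (splitAt a u))
    child-heightˢ (inj₁ x) u _ with FG.parent x in e
    child-heightˢ (inj₁ x) .(w ↑ˡ b) refl | just w rewrite splitAt-↑ˡ a w b = FG.child-height x w e
    child-heightˢ (inj₂ y) u _ with FH.parent y in e
    child-heightˢ (inj₂ y) .(a ↑ʳ w) refl | just w rewrite splitAt-↑ʳ a b w = FH.child-height y w e

    boundedˢ : ∀ s → heightˢ s ≤ d
    boundedˢ (inj₁ x) = FG.bounded x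
    boundedˢ (inj₂ y) = FH.bounded y

    parentᵁ : Fin (a + b) → Maybe (Fin (a + b))
    parentᵁ u = parentˢ (splitAt a u)

    Anc-↑ˡ : ∀ {x y} → Anc FG.parent x y → Anc parentᵁ (x ↑ˡ b) (y ↑ˡ b)
    Anc-↑ˡ = Anc-map (_↑ˡ b) λ v w e → trans (cong parentˢ (splitAt-↑ˡ a v b)) (cong (Maybe.map (_↑ˡ b)) e)

    Anc-↑ʳ : ∀ {x y} → Anc FH.parent x y → Anc parentᵁ (a ↑ʳ x) (a ↑ʳ y)
    Anc-↑ʳ = Anc-map (a ↑ʳ_) λ v w e → trans (cong parentˢ (splitAt-↑ʳ a b v)) (cong (Maybe.map (a ↑ʳ_)) e)

    edgesᵁ : ∀ u v → adj Union u v ≡ true → Anc parentᵁ u v ⊎ Anc parentᵁ v u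
    edgesᵁ u v e with splitAt a u in eu | splitAt a v in ev
    ... | inj₁ x | inj₁ y rewrite sym (splitAt⁻¹-↑ˡ eu) | sym (splitAt⁻¹-↑ˡ ev) =
      Sum.map Anc-↑ˡ Anc-↑ˡ (FG.edges x y e)
    ... | inj₂ x | inj₂ y rewrite sym (splitAt⁻¹-↑ʳ eu) | sym (splitAt⁻¹-↑ʳ ev) =
      Sum.map Anc-↑ʳ Anc-↑ʳ (FH.edges x y e)

    unionF : ElimForest Union d
    unionF = record
      { parent       = parentᵁ
      ; height       = heightˢ ∘ splitAt a
      ; root-height  = root-heightˢ ∘ splitAt a
      ; child-height = child-heightˢ ∘ splitAt a
      ; bounded      = boundedˢ ∘ splitAt a
      ; edges        = edgesᵁ }

module Cone {a : ℕ} (G : Graph a) where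
  cadj : Fin (suc a) → Fin (suc a) → Bool
  cadj zero    zero    = false
  cadj zero    (suc _) = true
  cadj (suc _) zero    = true
  cadj (suc x) (suc y) = adj G x y

  cadj-sym : ∀ u v → cadj u v ≡ cadj v u
  cadj-sym zero    zero    = refl
  cadj-sym zero    (suc _) = refl
  cadj-sym (suc _) zero    = refl
  cadj-sym (suc x) (suc y) = Graph.sym G x y

  cadj-irrefl : ∀ v → cadj v v ≡ false
  cadj-irrefl zero    = refl
  cadj-irrefl (suc x) = irrefl G x

  Cone : Graph (suc a)
  Cone = record { adj = cadj ; sym = cadj-sym ; irrefl = cadj-irrefl }

  lift : Cls a → Cls (suc a)
  lift C zero    = false
  lift C (suc x) = C x

  apex : Cls (suc a)
  apex zero    = true
  apex (suc _) = false

  size-lift : ∀ C → size (lift C) ≡ size C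
  size-lift C = ΣF-suc (ind ∘ lift C)

  size-apex : size apex ≡ 1
  size-apex = trans (ΣF-suc (ind ∘ apex)) (cong suc (ΣF-zero {a}))

  lift-disjoint : ∀ {C C′} → Disjoint C C′ → Disjoint (lift C) (lift C′)
  lift-disjoint dj zero    = λ ()
  lift-disjoint dj (suc x) = dj x

  lift-apex-disjoint : ∀ {C} → Disjoint (lift C) apex
  lift-apex-disjoint (suc _) _ = refl

  apex-lift-disjoint : ∀ {C} → Disjoint apex (lift C)
  apex-lift-disjoint zero _ = refl

  lift-joined : ∀ {C C′} → Joined G C C′ → Joined Cone (lift C) (lift C′)
  lift-joined j (suc x) (suc y) = j x y

  lift-apex-joined : ∀ {C} → Joined Cone (lift C) apex
  lift-apex-joined (suc _) zero _ _ = refl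

  apex-lift-joined : ∀ {C} → Joined Cone apex (lift C)
  apex-lift-joined zero (suc _) _ _ = refl

  module _ {d : ℕ} (FG : ElimForest G d) where
    module FG = ElimForest FG

    parentᶜ : Fin (suc a) → Maybe (Fin (suc a))
    parentᶜ zero    = nothing
    parentᶜ (suc x) = just (Maybe.maybe suc zero (FG.parent x))

    heightᶜ : Fin (suc a) → ℕ
    heightᶜ zero    = 0
    heightᶜ (suc x) = suc (FG.height x)

    child-heightᶜ : ∀ v u → parentᶜ v ≡ just u → heightᶜ v ≡ suc (heightᶜ u)
    child-heightᶜ (suc x) u _ with FG.parent x in e
    child-heightᶜ (suc x) .zero    refl | nothing = cong suc (FG.root-height x e)
    child-heightᶜ (suc x) .(suc w) refl | just w  = cong suc (FG.child-height x w e)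

    boundedᶜ : ∀ v → heightᶜ v ≤ suc d
    boundedᶜ zero    = z≤n
    boundedᶜ (suc x) = s≤s (FG.bounded x)

    Anc-suc : ∀ {x y} → Anc FG.parent x y → Anc parentᶜ (suc x) (suc y)
    Anc-suc = Anc-map suc λ v w e → cong (just ∘ Maybe.maybe suc zero) e

    apex≼ : ∀ k y → FG.height y ≡ k → Anc parentᶜ zero (suc y)
    apex≼ k y hy with FG.parent y in e
    ... | nothing = up (cong (just ∘ Maybe.maybe suc zero) e) here
    apex≼ zero    y hy | just w = ⊥-elim (0≢1+n (trans (sym hy) (FG.child-height y w e)))
    apex≼ (suc k) y hy | just w =
      up (cong (just ∘ Maybe.maybe suc zero) e) (apex≼ k w (suc-injective (trans (sym (FG.child-height y w e)) hy)))

    edgesᶜ : ∀ u v → cadj u v ≡ true → Anc parentᶜ u v ⊎ Anc parentᶜ v u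
    edgesᶜ zero    (suc y) _ = inj₁ (apex≼ _ y refl)
    edgesᶜ (suc x) zero    _ = inj₂ (apex≼ _ x refl)
    edgesᶜ (suc x) (suc y) e = Sum.map Anc-suc Anc-suc (FG.edges x y e)

    coneF : ElimForest Cone (suc d)
    coneF = record
      { parent = parentᶜ ; height = heightᶜ ; root-height = λ { zero _ → refl }
      ; child-height = child-heightᶜ ; bounded = boundedᶜ ; edges = edgesᶜ }

-- A clique on k + 2 vertices has no elimination forest of depth k: by
-- pigeonhole two of its (adjacent) vertices would have the same height.
clique-depth : ∀ {N} (G : Graph N) k (f : Fin (suc (suc k)) → Fin N) →
               (∀ i j → i ≢ j → adj G (f i) (f j) ≡ true) → ¬ ElimForest G k
clique-depth G k f clique F with pigeonhole (n<1+n (suc k)) (λ i → fromℕ< (s≤s (ElimForest.bounded F (f i))))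
... | i , j , i<j , same = Forest.adjacent-heights F (clique i j (Finₚ.<⇒≢ i<j))
  (trans (sym (toℕ-fromℕ< _)) (trans (cong toℕ same) (toℕ-fromℕ< _)))

last-connected : ∀ {A : Set} {R : A → A → Set} {xs y} → All (λ x → R x y) xs → Connected R (last xs) (just y)
last-connected []                = nothing-just
last-connected (r ∷ [])          = just r
last-connected (_ ∷ rs@(_ ∷ _)) = last-connected rs

head-connected : ∀ {A : Set} {R : A → A → Set} {x ys} → All (R x) ys → Connected R (just x) (head ys)
head-connected []      = just-nothing
head-connected (r ∷ _) = just r

-- The number of edges of the paths picked from the chains below (independent of q).
pathLen : ℕ → ℕ
pathLen zero    = 0
pathLen (suc d) = suc (suc (pathLen d + pathLen d))

module Tree (q : ℕ) where
  s : ℕ → ℕ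
  s zero    = q
  s (suc d) = suc (s d + s d)

  T : ∀ d → Graph (s d)
  T zero    = EmptyG q
  T (suc d) = Cone.Cone (Union.Union (T d) (T d))

  TF : ∀ d → ElimForest (T d) d
  TF zero    = emptyF q 0
  TF (suc d) = Cone.coneF (Union.Union (T d) (T d)) (Union.unionF (T d) (T d) (TF d) (TF d))

  module Step (d : ℕ) where
    module U = Union (T d) (T d)
    module C = Cone U.Union

    L R : Cls (s d) → Cls (s (suc d))
    L = C.lift ∘ U.left
    R = C.lift ∘ U.right

    step : List (Cls (s d)) → List (Cls (s (suc d)))
    step cs = map L cs ++ C.apex ∷ map R cs

    chain-step : ∀ {cs} → Chain (T d) cs → Chain (T (suc d)) (step cs)
    chain-step {cs} chain =
      AllPairsₚ.++⁺ (proj₁ chainL) (apex-R ∷ proj₁ chainR) L-rest ,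
      Linkedₚ.++⁺ (proj₂ chainL) (last-connected L-apex) (head-connected apex-R′ ∷′ proj₂ chainR)
      where
      chainL : Chain (T (suc d)) (map L cs)
      chainL = chain-map {GA = T d} {GB = T (suc d)} L
        (λ dj → C.lift-disjoint (U.left-disjoint dj)) (λ j → C.lift-joined (U.left-joined j)) chain
      chainR : Chain (T (suc d)) (map R cs)
      chainR = chain-map {GA = T d} {GB = T (suc d)} R
        (λ dj → C.lift-disjoint (U.right-disjoint dj)) (λ j → C.lift-joined (U.right-joined j)) chain
      each : ∀ {P : Cls (s (suc d)) → Set} (f : Cls (s d) → Cls (s (suc d))) → (∀ C → P (f C)) → All P (map f cs)
      each f p = Allₚ.map⁺ (All.universal p cs)
      apex-R : All (Disjoint C.apex) (map R cs)
      apex-R = each R (λ _ → C.apex-lift-disjoint)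
      apex-R′ : All (Joined (T (suc d)) C.apex) (map R cs)
      apex-R′ = each R (λ _ → C.apex-lift-joined)
      L-apex : All (λ X → Joined (T (suc d)) X C.apex) (map L cs)
      L-apex = each L (λ _ → C.lift-apex-joined)
      L-rest : All (λ X → All (Disjoint X) (C.apex ∷ map R cs)) (map L cs)
      L-rest = each L (λ _ → C.lift-apex-disjoint ∷ each R (λ _ → C.lift-disjoint U.left-right-disjoint))

    Π-step : ∀ cs → Π (step cs) ≡ Π cs * Π cs
    Π-step cs = begin
      Π (map L cs ++ C.apex ∷ map R cs)
        ≡⟨ Π-++ (map L cs) (C.apex ∷ map R cs) ⟩
      Π (map L cs) * (size C.apex * Π (map R cs))
        ≡⟨ cong₂ (λ x y → x * (y * Π (map R cs))) (Π-map L sizeL cs) C.size-apex ⟩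
      Π cs * (1 * Π (map R cs))
        ≡⟨ cong (Π cs *_) (trans (*-identityˡ _) (Π-map R sizeR cs)) ⟩
      Π cs * Π cs ∎
      where
      open ≡-Reasoning
      sizeL : ∀ X → size (L X) ≡ size X
      sizeL X = trans (C.size-lift (U.left X)) (U.size-left X)
      sizeR : ∀ X → size (R X) ≡ size X
      sizeR X = trans (C.size-lift (U.right X)) (U.size-right X)

  classes : ∀ d → List (Cls (s d))
  classes zero    = const true ∷ []
  classes (suc d) = Step.step d (classes d)

  chain-classes : ∀ d → Chain (T d) (classes d)
  chain-classes zero    = [] ∷ [] , [-]
  chain-classes (suc d) = Step.chain-step d (chain-classes d)

  Π-classes : ∀ d → Π (classes d) ≡ q ^ (2 ^ d)
  Π-classes zero    = trans (*-identityʳ (size {q} (const true))) (ΣF-const q 1)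
  Π-classes (suc d) =
    trans (Step.Π-step d (classes d)) (trans (cong (λ x → x * x) (Π-classes d)) (sym (^-double q d)))

  length-classes : ∀ d → length (classes d) ≡ suc (pathLen d)
  length-classes zero    = refl
  length-classes (suc d) = begin
    length (map L (classes d) ++ Step.C.apex d ∷ map R (classes d))
      ≡⟨ length-++ (map L (classes d)) ⟩
    length (map L (classes d)) + suc (length (map R (classes d)))
      ≡⟨ cong₂ (λ x y → x + suc y) (length-map L (classes d)) (length-map R (classes d)) ⟩
    length (classes d) + suc (length (classes d))
      ≡⟨ cong (λ x → x + suc x) (length-classes d) ⟩
    suc (pathLen d) + suc (suc (pathLen d))
      ≡⟨ cong suc (trans (+-suc (pathLen d) (suc (pathLen d))) (cong suc (+-suc (pathLen d) (pathLen d)))) ⟩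
    suc (suc (suc (pathLen d + pathLen d))) ∎
    where
    open ≡-Reasoning
    open Step d using (L; R)

  corner : ∀ d → Fin q → Fin (suc d) → Fin (s d)
  corner zero    t _       = t
  corner (suc d) t zero    = zero
  corner (suc d) t (suc i) = suc (corner d t i ↑ˡ s d)

  corner-clique : ∀ d t i j → i ≢ j → adj (T d) (corner d t i) (corner d t j) ≡ true
  corner-clique zero    t zero    zero    i≢j = ⊥-elim (i≢j refl)
  corner-clique (suc d) t zero    zero    i≢j = ⊥-elim (i≢j refl)
  corner-clique (suc d) t zero    (suc j) _   = refl
  corner-clique (suc d) t (suc i) zero    _   = refl
  corner-clique (suc d) t (suc i) (suc j) i≢j =
    trans (Union.adj-↑ˡ (T d) (T d) (corner d t i) (corner d t j)) (corner-clique d t i j (i≢j ∘ cong suc))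

  s-closed : ∀ d → suc (s d) ≡ 2 ^ d * suc q
  s-closed zero    = sym (+-identityʳ (suc q))
  s-closed (suc d) = begin
    suc (suc (s d + s d))        ≡⟨ cong suc (sym (+-suc (s d) (s d))) ⟩
    suc (s d) + suc (s d)        ≡⟨ cong (λ x → x + x) (s-closed d) ⟩
    2 ^ d * suc q + 2 ^ d * suc q ≡⟨ double (2 ^ d) (suc q) ⟩
    2 ^ suc d * suc q            ∎
    where
    open ≡-Reasoning
    double : ∀ p x → p * x + p * x ≡ (2 * p) * x
    double = solve-∀

padded-tree : ∀ d′ q → Fin q → ∀ pad → Σ (Graph (Tree.s q (suc d′) + pad)) λ G →
              HasTreeDepth G (suc d′) × q ^ (2 ^ suc d′) ≤ numPaths G (pathLen (suc d′))
padded-tree d′ q t pad = Union , (unionF (TF d) (emptyF pad d) , not-shallower) , count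
  where
  d : ℕ
  d = suc d′
  open Tree q
  open Union (T d) (EmptyG pad)
  not-shallower : ¬ ElimForest Union d′
  not-shallower = clique-depth Union d′ (λ i → corner d t i ↑ˡ pad)
    (λ i j i≢j → trans (adj-↑ˡ (corner d t i) (corner d t j)) (corner-clique d t i j i≢j))
  count : q ^ (2 ^ d) ≤ numPaths Union (pathLen d)
  count = begin
    q ^ (2 ^ d)                     ≡⟨ sym (Π-classes d) ⟩
    Π (classes d)                   ≡⟨ sym (Π-map left size-left (classes d)) ⟩
    Π (map left (classes d))
      ≤⟨ chain-paths Union (pathLen d) (chain-map {GA = T d} {GB = Union} left left-disjoint left-joined (chain-classes d))
                     (trans (length-map left (classes d)) (length-classes d)) ⟩
    numPaths Union (pathLen d)      ∎
    where open ≤-Reasoning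

*-^ : ∀ a b e → (a * b) ^ e ≡ a ^ e * b ^ e
*-^ a b zero    = refl
*-^ a b (suc e) = trans (cong (a * b *_) (*-^ a b e)) (regroup a b (a ^ e) (b ^ e))
  where
  regroup : ∀ a b x y → (a * b) * (x * y) ≡ (a * x) * (b * y)
  regroup = solve-∀

n<[1+n/D]D : ∀ n D .{{_ : NonZero D}} → n < suc (n / D) * D
n<[1+n/D]D n D = begin-strict
  n                   ≡⟨ m≡m%n+[m/n]*n n D ⟩
  n % D + (n / D) * D <⟨ +-monoˡ-< ((n / D) * D) (m%n<n n D) ⟩
  D + (n / D) * D     ∎
  where open ≤-Reasoning

[1+q]D≤2Dq : ∀ q D → 1 ≤ q → suc q * D ≤ (2 * D) * q
[1+q]D≤2Dq q D 1≤q = ≤-trans (*-monoˡ-≤ D (+-monoˡ-≤ q 1≤q)) (≤-reflexive (regroup D q))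
  where
  regroup : ∀ p q → (q + q) * p ≡ (2 * p) * q
  regroup = solve-∀

tree-size : ∀ q d → 1 ≤ q → Tree.s q d < q * 2 ^ suc d
tree-size q d 1≤q = begin-strict
  Tree.s q d        <⟨ n<1+n (Tree.s q d) ⟩
  suc (Tree.s q d)  ≡⟨ Tree.s-closed q d ⟩
  2 ^ d * suc q     ≤⟨ *-monoʳ-≤ (2 ^ d) (+-monoˡ-≤ q 1≤q) ⟩
  2 ^ d * (q + q)   ≡⟨ regroup (2 ^ d) q ⟩
  q * 2 ^ suc d     ∎
  where
  open ≤-Reasoning
  regroup : ∀ p q → p * (q + q) ≡ q * (2 * p)
  regroup = solve-∀

-- Lower bound of the theorem: with D = 2 ^ (d+1) and q = ⌊n / D⌋ ≥ 1 the tree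
-- T d fits into n vertices and n ≤ 2D·q, so n ^ 2 ^ d ≤ (2D) ^ 2 ^ d · q ^ 2 ^ d.
lower-bound : ∀ d′ → Σ ℕ λ c → Σ ℕ λ ℓ → Σ ℕ λ n₀ → ∀ (n : ℕ) → n₀ ≤ n →
              Σ (Graph n) λ G → HasTreeDepth G (suc d′) × (n ^ (2 ^ suc d′) ≤ suc c * numPaths G ℓ)
lower-bound d′ = (2 * D) ^ e , pathLen d , D , λ n D≤n →
  build n (n / D) (m≥n⇒m/n>0 D≤n) (m/n*n≤m n D) (n<[1+n/D]D n D)
  where
  d e D : ℕ
  d = suc d′
  e = 2 ^ d
  D = 2 ^ suc d
  instance
    D≢0 : NonZero D
    D≢0 = >-nonZero (m^n>0 2 (suc d))
  Goal : ℕ → ℕ → Set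
  Goal n m = Σ (Graph m) λ G → HasTreeDepth G d × (n ^ e ≤ suc ((2 * D) ^ e) * numPaths G (pathLen d))
  build : ∀ n q → 1 ≤ q → q * D ≤ n → n < suc q * D → Goal n n
  build n q@(suc _) 1≤q qD≤n n<[1+q]D = subst (Goal n) (m+[n∸m]≡n s≤n) (G , depth , bound)
    where
    s : ℕ
    s = Tree.s q d
    s≤n : s ≤ n
    s≤n = ≤-trans (<⇒≤ (tree-size q d 1≤q)) qD≤n
    tree : Σ (Graph (s + (n ∸ s))) λ G → HasTreeDepth G d × q ^ e ≤ numPaths G (pathLen d)
    tree = padded-tree d′ q zero (n ∸ s)
    G : Graph (s + (n ∸ s))
    G = proj₁ tree
    depth : HasTreeDepth G d
    depth = proj₁ (proj₂ tree)
    bound : n ^ e ≤ suc ((2 * D) ^ e) * numPaths G (pathLen d)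
    bound = begin
      n ^ e               ≤⟨ ^-monoˡ-≤ e (≤-trans (<⇒≤ n<[1+q]D) ([1+q]D≤2Dq q D 1≤q)) ⟩
      ((2 * D) * q) ^ e   ≡⟨ *-^ (2 * D) q e ⟩
      (2 * D) ^ e * q ^ e ≤⟨ *-mono-≤ (n≤1+n ((2 * D) ^ e)) (proj₂ (proj₂ tree)) ⟩
      suc ((2 * D) ^ e) * numPaths G (pathLen d) ∎
      where open ≤-Reasoning

mainTheorem5 : ∀ (d : ℕ) → 1 ≤ d →
    (Σ ℕ λ C → ∀ (n : ℕ) (G : Graph n) → TreeDepth≤ G d →
       ∀ (ℓ : ℕ) → numPaths G ℓ ≤ C * n ^ (2 ^ d))
    ×
    (Σ ℕ λ c → Σ ℕ λ ℓ → Σ ℕ λ n₀ → ∀ (n : ℕ) → n₀ ≤ n →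
       Σ (Graph n) λ G → HasTreeDepth G d × (n ^ (2 ^ d) ≤ suc c * numPaths G ℓ))
mainTheorem5 (suc d′) _ = upper-bound (suc d′) , lower-bound d′
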